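{- Let $n\ge 2$ and $r$ be integers. If $r > \binom{\lceil 2\sqrt{n}\rceil}{2}(n-1)+\lceil 2\sqrt{n}\rceil$, then ${\rm sg}(P_r\,\square\, P_n)= \lceil 2\sqrt{n}\, \rceil$.
   Context: $P_m$ denotes the path with vertex set $\{1,\dots,m\}$ and edges $\{i,i+1\}$. The Cartesian product $G\,\square\, H$ has vertex set $V(G)\times V(H)$, with $(g,h)$ adjacent to $(g',h')$ iff either $g=g'$ and $hh'\in E(H)$, or $h=h'$ and $gg'\in E(G)$. For a graph $G=(V,E)$ and $S\subseteq V$, for each pair $\{x,y\}\subseteq S$ with $x\neq y$ let $\widetilde{P}(x,y)$ be a selected fixed shortest $x,y$-path, and let $\widetilde{I}(S)=\{\widetilde{P}(x,y): x,y\in S\}$. $S$ is a strong geodetic set if for some such choice of geodesics, every vertex of $G$ lies on some path of $\widetilde{I}(S)$. The strong geodetic number ${\rm sg}(G)$ is the minimum cardinality of a strong geodetic set of $G$. -}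

module Defs where

open import Data.Nat using (ℕ; zero; suc; _+_; _*_; _≤_; _<_)
open import Data.Fin using (Fin; toℕ)
open import Data.Product using (Σ; _×_; _,_; ∃)
open import Data.Sum using (_⊎_)
open import Data.List using (List; []; _∷_; length; lookup)
open import Data.List.Membership.Propositional using (_∈_)
open import Data.List.Relation.Unary.Unique.Propositional using (Unique)
open import Relation.Binary.PropositionalEquality using (_≡_)

data Walk {V : Set} (E : V → V → Set) : V → V → Set where
  stop : (x : V) → Walk E x x
  step : {x y z : V} → E x y → Walk E y z → Walk E x z

walkLength : {V : Set} {E : V → V → Set} {x y : V} → Walk E x y → ℕ
walkLength (stop x) = zero
walkLength (step e w) = suc (walkLength w)

walkVertices : {V : Set} {E : V → V → Set} {x y : V} → Walk E x y → List V
walkVertices (stop x) = x ∷ []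
walkVertices {x = x} (step e w) = x ∷ walkVertices w

IsGeodesic : {V : Set} {E : V → V → Set} {x y : V} → Walk E x y → Set
IsGeodesic {V} {E} {x} {y} w = (w' : Walk E x y) → walkLength w ≤ walkLength w'

-- S (a list of distinct vertices) is a strong geodetic set: one geodesic is
-- selected for each unordered pair {S_i, S_j} (i < j), and every vertex lies
-- on some selected geodesic.
IsStrongGeodeticSet : {V : Set} (E : V → V → Set) → List V → Set
IsStrongGeodeticSet {V} E S =
  Unique S ×
  Σ ((i j : Fin (length S)) → toℕ i < toℕ j → Walk E (lookup S i) (lookup S j))
    (λ P →
      ((i j : Fin (length S)) (h : toℕ i < toℕ j) → IsGeodesic (P i j h)) ×
      ((v : V) → Σ (Fin (length S)) λ i → Σ (Fin (length S)) λ j →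
                  Σ (toℕ i < toℕ j) λ h → v ∈ walkVertices (P i j h)))

StrongGeodeticNumberIs : {V : Set} (E : V → V → Set) → ℕ → Set
StrongGeodeticNumberIs {V} E k =
  (Σ (List V) λ S → IsStrongGeodeticSet E S × length S ≡ k) ×
  ((S : List V) → IsStrongGeodeticSet E S → k ≤ length S)

-- Path P_m on vertices Fin m (vertex i ↔ i+1), edges {i, i+1}.
PathAdj : (m : ℕ) → Fin m → Fin m → Set
PathAdj m i j = suc (toℕ i) ≡ toℕ j ⊎ suc (toℕ j) ≡ toℕ i

CartAdj : {A B : Set} → (A → A → Set) → (B → B → Set) → (A × B) → (A × B) → Set
CartAdj EG EH (g , h) (g' , h') = (g ≡ g' × EH h h') ⊎ (h ≡ h' × EG g g')

GridAdj : (r n : ℕ) → (Fin r × Fin n) → (Fin r × Fin n) → Set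
GridAdj r n = CartAdj (PathAdj r) (PathAdj n)

-- k = ⌈2√n⌉  ⇔  k ≥ 2√n and k-1 < 2√n  ⇔  4n ≤ k² and every j < k has j² < 4n.
IsCeil2Sqrt : ℕ → ℕ → Set
IsCeil2Sqrt n k = 4 * n ≤ k * k × ((j : ℕ) → j < k → j * j < 4 * n)

-- Lower bound. Let S be a strong geodetic set with s elements. Each of the C(s,2) selected
-- geodesics makes at most n - 1 vertical steps, so if r > C(s,2)(n - 1) + s there is a column c
-- containing no vertex of S and no vertical step of a selected geodesic. A geodesic of the grid
-- is monotone in both coordinates, so it meets column c in at most one vertex, and only if its
-- endpoints lie strictly on opposite sides of c. The n vertices of column c are therefore
-- covered by distinct pairs (l, ρ) with l ∈ L and ρ ∈ R, the elements of S left and right of c,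
-- whence n ≤ |L| |R| ≤ s²/4.
--
-- Upper bound. Write k = (α + 1) + (β + 1) with n ≤ (α + 1)(β + 1) and α(β + 1) < n. Put α + 1
-- vertices in the first column at rows i(β + 1) + β (the last one capped at the top row) and
-- β + 1 vertices in the last column at rows t ≤ β. The geodesic between a left vertex at row p
-- and the right vertex at row t goes vertically to row p + t - β, then horizontally. Every row y
-- is reached this way (take i = ⌊y / (β + 1)⌋ and t = y + β - p), so every vertex lies on one of
-- the horizontal segments.

module Submission where

open import Defs
open import Data.Nat
  using (ℕ; zero; suc; _+_; _*_; _∸_; _≤_; _<_; z≤n; s≤s; s≤s⁻¹; ∣_-_∣; _⊓_; _/_; _≤?_; _<?_; _≟_)
open import Data.Nat.Properties
open import Data.Nat.Combinatorics using (_C_; nC1≡n; nCk+nC[k+1]≡[n+1]C[k+1])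
open import Data.Nat.DivMod using (m≡m%n+[m/n]*n; m%n<n; m/n*n≤m; m<n*o⇒m/o<n)
open import Data.Nat.Tactic.RingSolver using (solve-∀)
open import Algebra.Properties.CommutativeSemigroup +-commutativeSemigroup using (interchange)
open import Data.Fin using (Fin; toℕ; fromℕ<; fromℕ; inject≤) renaming (zero to fzero; suc to fsuc)
open import Data.Fin.Properties
  using (toℕ-injective; toℕ-fromℕ<; toℕ-fromℕ; toℕ<n; toℕ-inject≤; inject≤-injective; injective⇒≤; ¬∀⟶∃¬)
  renaming (0≢1+n to fzero≢fsuc)
open import Data.Product using (Σ; _×_; _,_; proj₁; proj₂)
open import Data.Sum using (_⊎_; inj₁; inj₂)
open import Data.List using (List; []; _∷_; length; lookup; map; _++_; filter; cartesianProduct; allFin)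
open import Data.List.Properties using (length-++; length-map; length-tabulate)
open import Data.List.Membership.Propositional using (_∈_; _∉_)
open import Data.List.Membership.Propositional.Properties
  using (∈-++⁺ˡ; ∈-++⁺ʳ; ∈-++⁻; ∈-map⁺; ∈-map⁻; ∈-lookup; ∈-allFin; ∈-filter⁺; ∈-cartesianProduct⁺)
open import Data.List.Relation.Unary.Any using (here; there; index)
open import Data.List.Relation.Unary.Any.Properties using (lookup-index)
open import Data.List.Relation.Unary.Unique.Propositional using (Unique)
open import Data.List.Relation.Unary.Unique.Propositional.Properties using (map⁺; ++⁺; allFin⁺)
open import Data.Empty using (⊥-elim)
open import Function using (_∘_)
open import Relation.Nullary using (¬_; Dec; yes; no)
open import Relation.Unary using (Decidable)
open import Relation.Binary.Definitions using (tri<; tri≈; tri>)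
open import Relation.Binary.PropositionalEquality

module _ {V : Set} {E : V → V → Set} where

  _++ʷ_ : ∀ {x y z} → Walk E x y → Walk E y z → Walk E x z
  stop _ ++ʷ w = w
  step e w₁ ++ʷ w₂ = step e (w₁ ++ʷ w₂)

  length-++ʷ : ∀ {x y z} (w₁ : Walk E x y) (w₂ : Walk E y z) →
               walkLength (w₁ ++ʷ w₂) ≡ walkLength w₁ + walkLength w₂
  length-++ʷ (stop _) w₂ = refl
  length-++ʷ (step e w₁) w₂ = cong suc (length-++ʷ w₁ w₂)

  start∈walkVertices : ∀ {x y} (w : Walk E x y) → x ∈ walkVertices w
  start∈walkVertices (stop _) = here refl
  start∈walkVertices (step e w) = here refl

  ∈-++ʷ⁺ˡ : ∀ {x y z v} (w₁ : Walk E x y) (w₂ : Walk E y z) →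
            v ∈ walkVertices w₁ → v ∈ walkVertices (w₁ ++ʷ w₂)
  ∈-++ʷ⁺ˡ (stop _) w₂ (here refl) = start∈walkVertices w₂
  ∈-++ʷ⁺ˡ (step e w₁) w₂ (here p) = here p
  ∈-++ʷ⁺ˡ (step e w₁) w₂ (there p) = there (∈-++ʷ⁺ˡ w₁ w₂ p)

  ∈-++ʷ⁺ʳ : ∀ {x y z v} (w₁ : Walk E x y) (w₂ : Walk E y z) →
            v ∈ walkVertices w₂ → v ∈ walkVertices (w₁ ++ʷ w₂)
  ∈-++ʷ⁺ʳ (stop _) w₂ p = p
  ∈-++ʷ⁺ʳ (step e w₁) w₂ p = there (∈-++ʷ⁺ʳ w₁ w₂ p)

  ∈-++ʷ⁻ : ∀ {x y z v} (w₁ : Walk E x y) (w₂ : Walk E y z) →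
           v ∈ walkVertices (w₁ ++ʷ w₂) → v ∈ walkVertices w₁ ⊎ v ∈ walkVertices w₂
  ∈-++ʷ⁻ (stop _) w₂ p = inj₂ p
  ∈-++ʷ⁻ (step e w₁) w₂ (here p) = inj₁ (here p)
  ∈-++ʷ⁻ (step e w₁) w₂ (there p) with ∈-++ʷ⁻ w₁ w₂ p
  ... | inj₁ q = inj₁ (there q)
  ... | inj₂ q = inj₂ q

  splitʷ : ∀ {x y v} (w : Walk E x y) → v ∈ walkVertices w →
           Σ (Walk E x v) λ w₁ → Σ (Walk E v y) λ w₂ → w ≡ w₁ ++ʷ w₂
  splitʷ (stop _) (here refl) = stop _ , stop _ , refl
  splitʷ (step e w) (here refl) = stop _ , step e w , refl
  splitʷ (step e w) (there p) with splitʷ w p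
  ... | w₁ , w₂ , refl = step e w₁ , w₂ , refl

  reverseʷ : (∀ {x y} → E x y → E y x) → ∀ {x y} → Walk E x y → Walk E y x
  reverseʷ sym-E (stop x) = stop x
  reverseʷ sym-E (step e w) = reverseʷ sym-E w ++ʷ step (sym-E e) (stop _)

  length-reverseʷ : (sym-E : ∀ {x y} → E x y → E y x) → ∀ {x y} (w : Walk E x y) →
                    walkLength (reverseʷ sym-E w) ≡ walkLength w
  length-reverseʷ sym-E (stop x) = refl
  length-reverseʷ sym-E (step e w) =
    trans (length-++ʷ (reverseʷ sym-E w) _) (trans (+-comm _ 1) (cong suc (length-reverseʷ sym-E w)))

Between : ℕ → ℕ → ℕ → Set
Between a c b = (a ≤ c × c ≤ b) ⊎ (b ≤ c × c ≤ a)
module _ {A B : Set} {EA : A → A → Set} {EB : B → B → Set}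
         (f : A → B) (f-E : ∀ {x y} → EA x y → EB (f x) (f y)) where

  mapʷ : ∀ {x y} → Walk EA x y → Walk EB (f x) (f y)
  mapʷ (stop x) = stop (f x)
  mapʷ (step e w) = step (f-E e) (mapʷ w)

  length-mapʷ : ∀ {x y} (w : Walk EA x y) → walkLength (mapʷ w) ≡ walkLength w
  length-mapʷ (stop x) = refl
  length-mapʷ (step e w) = cong suc (length-mapʷ w)

  ∈-mapʷ⁺ : ∀ {x y a} (w : Walk EA x y) → a ∈ walkVertices w → f a ∈ walkVertices (mapʷ w)
  ∈-mapʷ⁺ (stop x) (here refl) = here refl
  ∈-mapʷ⁺ (step e w) (here refl) = here refl
  ∈-mapʷ⁺ (step e w) (there p) = there (∈-mapʷ⁺ w p)

isStrongGeodeticSet-fromWalks :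
  ∀ {V : Set} {E : V → V → Set} (S : List V) → Unique S → (Q : (u v : V) → Walk E u v) →
  (∀ {u v} → u ∈ S → v ∈ S → IsGeodesic (Q u v)) →
  (∀ z → Σ V λ u → Σ V λ v → u ∈ S × v ∈ S × u ≢ v × z ∈ walkVertices (Q u v) × z ∈ walkVertices (Q v u)) →
  IsStrongGeodeticSet E S
isStrongGeodeticSet-fromWalks {V} {E} S unique Q geodesic covered =
  unique , (λ i j _ → Q (lookup S i) (lookup S j)) , (λ i j _ → geodesic (∈-lookup i) (∈-lookup j)) , cover
  where
  cover : ∀ z → Σ (Fin (length S)) λ i → Σ (Fin (length S)) λ j →
                Σ (toℕ i < toℕ j) λ _ → z ∈ walkVertices (Q (lookup S i) (lookup S j))
  cover z with u , v , u∈ , v∈ , u≢v , z∈uv , z∈vu ← covered z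
             | <-cmp (toℕ (index u∈)) (toℕ (index v∈))
  ... | tri< lt _ _ = index u∈ , index v∈ , lt ,
          subst₂ (λ a b → z ∈ walkVertices (Q a b)) (lookup-index u∈) (lookup-index v∈) z∈uv
  ... | tri≈ _ eq _ =
          ⊥-elim (u≢v (trans (lookup-index u∈) (trans (cong (lookup S) (toℕ-injective eq)) (sym (lookup-index v∈)))))
  ... | tri> _ _ gt = index v∈ , index u∈ , gt ,
          subst₂ (λ a b → z ∈ walkVertices (Q a b)) (lookup-index v∈) (lookup-index u∈) z∈vu

injection⇒≤length : ∀ {A : Set} {N} (f : Fin N → A) → (∀ {i j} → f i ≡ f j → i ≡ j) →
                    {xs : List A} → (∀ i → f i ∈ xs) → N ≤ length xs
injection⇒≤length f f-inj {xs} f∈ = injective⇒≤ index-injective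
  where
  index-injective : ∀ {i j} → index (f∈ i) ≡ index (f∈ j) → i ≡ j
  index-injective {i} {j} eq =
    f-inj (trans (lookup-index (f∈ i)) (trans (cong (lookup xs) eq) (sym (lookup-index (f∈ j)))))

short⇒∃∉ : ∀ {r} (xs : List (Fin r)) → length xs < r → Σ (Fin r) (_∉ xs)
short⇒∃∉ {r} xs lt = ¬∀⟶∃¬ r (_∈ xs) (_∈? xs) (λ all∈ → <⇒≱ lt (injection⇒≤length (λ c → c) (λ e → e) all∈))
  where open import Data.List.Membership.DecPropositional (Data.Fin._≟_ {r}) using (_∈?_)

length-cartesianProduct : ∀ {A B : Set} (xs : List A) (ys : List B) →
                          length (cartesianProduct xs ys) ≡ length xs * length ys
length-cartesianProduct [] ys = refl
length-cartesianProduct (x ∷ xs) ys =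
  trans (length-++ (map (x ,_) ys)) (cong₂ _+_ (length-map (x ,_) ys) (length-cartesianProduct xs ys))

length-filter-disjoint : ∀ {A : Set} {P Q : A → Set} (P? : Decidable P) (Q? : Decidable Q) →
                         (∀ {x} → P x → ¬ Q x) → (xs : List A) →
                         length (filter P? xs) + length (filter Q? xs) ≤ length xs
length-filter-disjoint P? Q? disj [] = z≤n
length-filter-disjoint P? Q? disj (x ∷ xs) with ih ← length-filter-disjoint P? Q? disj xs | P? x | Q? x
... | yes p | yes q = ⊥-elim (disj p q)
... | yes p | no ¬q = s≤s ih
... | no ¬p | yes q = ≤-trans (≤-reflexive (+-suc _ _)) (s≤s ih)
... | no ¬p | no ¬q = m≤n⇒m≤1+n ih

n+nC2≡[1+n]C2 : ∀ n → n + n C 2 ≡ suc n C 2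
n+nC2≡[1+n]C2 n = trans (cong (_+ n C 2) (sym (nC1≡n n))) (nCk+nC[k+1]≡[n+1]C[k+1] n 1)

nC2-mono : ∀ {m n} → m ≤ n → m C 2 ≤ n C 2
nC2-mono {n = zero} z≤n = ≤-refl
nC2-mono {m} {suc n} m≤1+n with m≤n⇒m<n∨m≡n m≤1+n
... | inj₁ m<1+n = ≤-trans (nC2-mono (s≤s⁻¹ m<1+n)) (≤-trans (m≤n+m (n C 2) n) (≤-reflexive (n+nC2≡[1+n]C2 n)))
... | inj₂ refl = ≤-refl

unionOver : ∀ {A : Set} (t L : ℕ) (F : Fin t → List A) → (∀ j → length (F j) ≤ L) →
            Σ (List A) λ xs → length xs ≤ t * L × (∀ j {a} → a ∈ F j → a ∈ xs)
unionOver zero L F bound = [] , z≤n , λ ()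
unionOver (suc t) L F bound with xs , len , sub ← unionOver t L (λ j → F (fsuc j)) (λ j → bound (fsuc j)) =
  F fzero ++ xs ,
  ≤-trans (≤-reflexive (length-++ (F fzero))) (+-mono-≤ (bound fzero) len) ,
  λ { fzero a∈ → ∈-++⁺ˡ a∈ ; (fsuc j) a∈ → ∈-++⁺ʳ (F fzero) (sub j a∈) }

unionOverPairs : ∀ {A : Set} (s L : ℕ) (F : (i j : Fin s) → toℕ i < toℕ j → List A) →
                 (∀ i j h → length (F i j h) ≤ L) →
                 Σ (List A) λ xs → length xs ≤ (s C 2) * L × (∀ i j h {a} → a ∈ F i j h → a ∈ xs)
unionOverPairs zero L F bound = [] , z≤n , λ ()
unionOverPairs (suc s) L F bound
  with xs₀ , len₀ , sub₀ ← unionOver s L (λ j → F fzero (fsuc j) (s≤s z≤n))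
                                         (λ j → bound fzero (fsuc j) (s≤s z≤n))
     | xs₁ , len₁ , sub₁ ← unionOverPairs s L (λ i j h → F (fsuc i) (fsuc j) (s≤s h))
                                              (λ i j h → bound (fsuc i) (fsuc j) (s≤s h))
  = xs₀ ++ xs₁ , length≤ , sub
  where
  length≤ : length (xs₀ ++ xs₁) ≤ (suc s C 2) * L
  length≤ = begin
    length (xs₀ ++ xs₁)     ≡⟨ length-++ xs₀ ⟩
    length xs₀ + length xs₁ ≤⟨ +-mono-≤ len₀ len₁ ⟩
    s * L + (s C 2) * L     ≡⟨ *-distribʳ-+ L s (s C 2) ⟨
    (s + s C 2) * L         ≡⟨ cong (_* L) (n+nC2≡[1+n]C2 s) ⟩
    (suc s C 2) * L         ∎
    where open ≤-Reasoning
  sub : ∀ i j h {a} → a ∈ F i j h → a ∈ xs₀ ++ xs₁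
  sub fzero (fsuc j) (s≤s z≤n) a∈ = ∈-++⁺ˡ (sub₀ j a∈)
  sub (fsuc i) (fsuc j) (s≤s h) a∈ = ∈-++⁺ʳ xs₀ (sub₁ i j h a∈)


between-refl : ∀ a b → Between a a b
between-refl a b with ≤-total a b
... | inj₁ a≤b = inj₁ (≤-refl , a≤b)
... | inj₂ b≤a = inj₂ (b≤a , ≤-refl)

Between⇒∣-∣-additive : ∀ a c b → Between a c b → ∣ a - c ∣ + ∣ c - b ∣ ≡ ∣ a - b ∣
Between⇒∣-∣-additive a c b (inj₁ (a≤c , c≤b))
  with d₁ , refl ← m≤n⇒∃[o]m+o≡n a≤c | d₂ , refl ← m≤n⇒∃[o]m+o≡n c≤b = begin
    ∣ a - a + d₁ ∣ + ∣ a + d₁ - a + d₁ + d₂ ∣ ≡⟨ cong₂ _+_ (∣m-m+n∣≡n a d₁) (∣m-m+n∣≡n (a + d₁) d₂) ⟩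
    d₁ + d₂                                   ≡⟨ ∣m-m+n∣≡n a (d₁ + d₂) ⟨
    ∣ a - a + (d₁ + d₂) ∣                     ≡⟨ cong (λ t → ∣ a - t ∣) (+-assoc a d₁ d₂) ⟨
    ∣ a - a + d₁ + d₂ ∣                       ∎
  where open ≡-Reasoning
Between⇒∣-∣-additive a c b (inj₂ b≤c≤a) = begin
  ∣ a - c ∣ + ∣ c - b ∣ ≡⟨ cong₂ _+_ (∣-∣-comm a c) (∣-∣-comm c b) ⟩
  ∣ c - a ∣ + ∣ b - c ∣ ≡⟨ +-comm ∣ c - a ∣ ∣ b - c ∣ ⟩
  ∣ b - c ∣ + ∣ c - a ∣ ≡⟨ Between⇒∣-∣-additive b c a (inj₁ b≤c≤a) ⟩
  ∣ b - a ∣             ≡⟨ ∣-∣-comm b a ⟩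
  ∣ a - b ∣             ∎
  where open ≡-Reasoning

∣-∣-additive⇒Between : ∀ a c b → ∣ a - c ∣ + ∣ c - b ∣ ≤ ∣ a - b ∣ → Between a c b
∣-∣-additive⇒Between zero c b h = inj₁ (z≤n , ≤-trans (m≤m+n c ∣ c - b ∣) h)
∣-∣-additive⇒Between (suc a) c zero h =
  inj₂ (z≤n , ≤-trans (m≤n+m c ∣ suc a - c ∣) (subst (λ t → ∣ suc a - c ∣ + t ≤ suc a) (∣-∣-identityʳ c) h))
∣-∣-additive⇒Between (suc a) zero (suc b) h =
  ⊥-elim (<⇒≱ (s≤s (≤-trans (∣m-n∣≤m⊔n a b) (≤-trans (m⊔n≤m+n a b) (+-monoʳ-≤ a (n≤1+n b))))) h)
∣-∣-additive⇒Between (suc a) (suc c) (suc b) h with ∣-∣-additive⇒Between a c b h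
... | inj₁ (p , q) = inj₁ (s≤s p , s≤s q)
... | inj₂ (p , q) = inj₂ (s≤s p , s≤s q)

Between-strict : ∀ {a c b} → Between a c b → a ≢ c → b ≢ c → (a < c × c < b) ⊎ (b < c × c < a)
Between-strict (inj₁ (p , q)) a≢c b≢c = inj₁ (≤∧≢⇒< p a≢c , ≤∧≢⇒< q (≢-sym b≢c))
Between-strict (inj₂ (p , q)) a≢c b≢c = inj₂ (≤∧≢⇒< p b≢c , ≤∧≢⇒< q (≢-sym a≢c))

Between-step : ∀ {a b x c} → suc a ≡ b ⊎ suc b ≡ a → x ≢ a → Between a x c → Between b x c
Between-step (inj₁ refl) x≢a (inj₁ (a≤x , x≤c)) = inj₁ (≤∧≢⇒< a≤x (≢-sym x≢a) , x≤c)
Between-step (inj₁ refl) x≢a (inj₂ (c≤x , x≤a)) = inj₂ (c≤x , m≤n⇒m≤1+n x≤a)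
Between-step (inj₂ refl) x≢a (inj₁ (a≤x , x≤c)) = inj₁ (≤-trans (n≤1+n _) a≤x , x≤c)
Between-step (inj₂ refl) x≢a (inj₂ (c≤x , x≤a)) = inj₂ (c≤x , s≤s⁻¹ (≤∧≢⇒< x≤a x≢a))

module _ {m : ℕ} where

  pathAdj-sym : ∀ {i j : Fin m} → PathAdj m i j → PathAdj m j i
  pathAdj-sym (inj₁ e) = inj₂ e
  pathAdj-sym (inj₂ e) = inj₁ e

  pathAdj⇒∣-∣≡1 : ∀ {i j : Fin m} → PathAdj m i j → ∣ toℕ i - toℕ j ∣ ≡ 1
  pathAdj⇒∣-∣≡1 {i} {j} (inj₁ e) =
    subst (λ t → ∣ toℕ i - t ∣ ≡ 1) e (trans (m≤n⇒∣m-n∣≡n∸m (n≤1+n (toℕ i))) (m+n∸n≡m 1 (toℕ i)))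
  pathAdj⇒∣-∣≡1 {i} {j} (inj₂ e) =
    subst (λ t → ∣ t - toℕ j ∣ ≡ 1) e (trans (m≤n⇒∣n-m∣≡n∸m (n≤1+n (toℕ j))) (m+n∸n≡m 1 (toℕ j)))

  ascendingWalk : (i j : Fin m) (d : ℕ) → toℕ i + d ≡ toℕ j →
                  Σ (Walk (PathAdj m) i j) λ w → walkLength w ≡ d
  ascendingWalk i j zero eq with refl ← toℕ-injective (trans (sym (+-identityʳ (toℕ i))) eq) = stop i , refl
  ascendingWalk i j (suc d) eq = step (inj₁ (sym (toℕ-fromℕ< i+1<m))) (proj₁ rest) , cong suc (proj₂ rest)
    where
    i+1<m : suc (toℕ i) < m
    i+1<m = ≤-<-trans (≤-trans (m≤m+n (suc (toℕ i)) d) (≤-reflexive (trans (sym (+-suc (toℕ i) d)) eq))) (toℕ<n j)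
    i+1+d≡j : toℕ (fromℕ< i+1<m) + d ≡ toℕ j
    i+1+d≡j = trans (cong (_+ d) (toℕ-fromℕ< i+1<m)) (trans (sym (+-suc (toℕ i) d)) eq)
    rest = ascendingWalk (fromℕ< i+1<m) j d i+1+d≡j

  pathWalk : (i j : Fin m) → Σ (Walk (PathAdj m) i j) λ w → walkLength w ≡ ∣ toℕ i - toℕ j ∣
  pathWalk i j with toℕ i ≤? toℕ j
  ... | yes i≤j with w , len ← ascendingWalk i j (toℕ j ∸ toℕ i) (m+[n∸m]≡n i≤j) =
    w , trans len (sym (m≤n⇒∣m-n∣≡n∸m i≤j))
  ... | no i≰j with w , len ← ascendingWalk j i (toℕ i ∸ toℕ j) (m+[n∸m]≡n (≰⇒≥ i≰j)) =
    reverseʷ pathAdj-sym w ,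
    trans (length-reverseʷ pathAdj-sym w) (trans len (sym (m≤n⇒∣n-m∣≡n∸m (≰⇒≥ i≰j))))

  between-visited : ∀ {a c : Fin m} (w : Walk (PathAdj m) a c) (x : Fin m) →
                    Between (toℕ a) (toℕ x) (toℕ c) → x ∈ walkVertices w
  between-visited (stop _) x (inj₁ (p , q)) = here (toℕ-injective (≤-antisym q p))
  between-visited (stop _) x (inj₂ (p , q)) = here (toℕ-injective (≤-antisym q p))
  between-visited {a} (step e w) x btw with toℕ x ≟ toℕ a
  ... | yes x≡a = here (toℕ-injective x≡a)
  ... | no x≢a = there (between-visited w x (Between-step e x≢a btw))

module Grid (r n : ℕ) where

  V : Set
  V = Fin r × Fin n

  E : V → V → Set
  E = GridAdj r n

  col row : V → ℕ
  col u = toℕ (proj₁ u)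
  row u = toℕ (proj₂ u)

  dist : V → V → ℕ
  dist u v = ∣ col u - col v ∣ + ∣ row u - row v ∣

  private
    ∣-∣-step : ∀ a b c → ∣ a - b ∣ ≡ 1 → ∣ a - c ∣ ≤ suc ∣ b - c ∣
    ∣-∣-step a b c e = subst (λ t → ∣ a - c ∣ ≤ t + ∣ b - c ∣) e (∣-∣-triangle a b c)

  dist-step : ∀ {u v} w → E u v → dist u w ≤ suc (dist v w)
  dist-step {x , y} {.x , y'} w (inj₁ (refl , e)) =
    ≤-trans (+-monoʳ-≤ ∣ toℕ x - col w ∣ (∣-∣-step (toℕ y) (toℕ y') (row w) (pathAdj⇒∣-∣≡1 e)))
            (≤-reflexive (+-suc _ _))
  dist-step {x , y} {x' , .y} w (inj₂ (refl , e)) =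
    +-monoˡ-≤ ∣ toℕ y - row w ∣ (∣-∣-step (toℕ x) (toℕ x') (col w) (pathAdj⇒∣-∣≡1 e))

  dist≤walkLength : ∀ {u v} (w : Walk E u v) → dist u v ≤ walkLength w
  dist≤walkLength {u} (stop _) = ≤-reflexive (cong₂ _+_ (∣n-n∣≡0 (col u)) (∣n-n∣≡0 (row u)))
  dist≤walkLength {u} {v} (step e w) = ≤-trans (dist-step v e) (s≤s (dist≤walkLength w))

  dist-triangle : ∀ u x v → dist u v ≤ dist u x + dist x v
  dist-triangle u x v =
    ≤-trans (+-mono-≤ (∣-∣-triangle (col u) (col x) (col v)) (∣-∣-triangle (row u) (row x) (row v)))
            (≤-reflexive (interchange ∣ col u - col x ∣ ∣ col x - col v ∣ ∣ row u - row x ∣ ∣ row x - row v ∣))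

  horizontalSteps : ∀ {u v} → Walk E u v → ℕ
  horizontalSteps (stop _) = 0
  horizontalSteps (step (inj₁ _) w) = horizontalSteps w
  horizontalSteps (step (inj₂ _) w) = suc (horizontalSteps w)

  verticalCols : ∀ {u v} → Walk E u v → List (Fin r)
  verticalCols (stop _) = []
  verticalCols {u} (step (inj₁ _) w) = proj₁ u ∷ verticalCols w
  verticalCols (step (inj₂ _) w) = verticalCols w

  walkLength≡horizontal+vertical : ∀ {u v} (w : Walk E u v) →
                                   walkLength w ≡ horizontalSteps w + length (verticalCols w)
  walkLength≡horizontal+vertical (stop _) = refl
  walkLength≡horizontal+vertical (step (inj₁ _) w) =
    trans (cong suc (walkLength≡horizontal+vertical w)) (sym (+-suc _ _))
  walkLength≡horizontal+vertical (step (inj₂ _) w) = cong suc (walkLength≡horizontal+vertical w)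

  ∣Δcol∣≤horizontalSteps : ∀ {u v} (w : Walk E u v) → ∣ col u - col v ∣ ≤ horizontalSteps w
  ∣Δcol∣≤horizontalSteps {u} (stop _) = ≤-reflexive (∣n-n∣≡0 (col u))
  ∣Δcol∣≤horizontalSteps (step (inj₁ (refl , _)) w) = ∣Δcol∣≤horizontalSteps w
  ∣Δcol∣≤horizontalSteps {u} {v} (step (inj₂ (_ , e)) w) =
    ≤-trans (∣-∣-step (col u) _ (col v) (pathAdj⇒∣-∣≡1 e)) (s≤s (∣Δcol∣≤horizontalSteps w))

  ∈-verticalCols-++ʷ⁺ˡ : ∀ {x y z c} (w₁ : Walk E x y) (w₂ : Walk E y z) →
                         c ∈ verticalCols w₁ → c ∈ verticalCols (w₁ ++ʷ w₂)
  ∈-verticalCols-++ʷ⁺ˡ (step (inj₁ _) w₁) w₂ (here p) = here p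
  ∈-verticalCols-++ʷ⁺ˡ (step (inj₁ _) w₁) w₂ (there p) = there (∈-verticalCols-++ʷ⁺ˡ w₁ w₂ p)
  ∈-verticalCols-++ʷ⁺ˡ (step (inj₂ _) w₁) w₂ p = ∈-verticalCols-++ʷ⁺ˡ w₁ w₂ p

  ∈-verticalCols-++ʷ⁺ʳ : ∀ {x y z c} (w₁ : Walk E x y) (w₂ : Walk E y z) →
                         c ∈ verticalCols w₂ → c ∈ verticalCols (w₁ ++ʷ w₂)
  ∈-verticalCols-++ʷ⁺ʳ (stop _) w₂ p = p
  ∈-verticalCols-++ʷ⁺ʳ (step (inj₁ _) w₁) w₂ p = there (∈-verticalCols-++ʷ⁺ʳ w₁ w₂ p)
  ∈-verticalCols-++ʷ⁺ʳ (step (inj₂ _) w₁) w₂ p = ∈-verticalCols-++ʷ⁺ʳ w₁ w₂ p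

  vertical : (x : Fin r) {y₁ y₂ : Fin n} → Walk (PathAdj n) y₁ y₂ → Walk E (x , y₁) (x , y₂)
  vertical x = mapʷ (x ,_) (λ e → inj₁ (refl , e))

  horizontal : (y : Fin n) {x₁ x₂ : Fin r} → Walk (PathAdj r) x₁ x₂ → Walk E (x₁ , y) (x₂ , y)
  horizontal y = mapʷ (_, y) (λ e → inj₂ (refl , e))

  lShape : (u v : V) → Fin n → Walk E u v
  lShape (x₁ , y₁) (x₂ , y₂) y =
    vertical x₁ (proj₁ (pathWalk y₁ y)) ++ʷ
    (horizontal y (proj₁ (pathWalk x₁ x₂)) ++ʷ vertical x₂ (proj₁ (pathWalk y y₂)))

  walkLength-lShape : ∀ u v y → Between (row u) (toℕ y) (row v) → walkLength (lShape u v y) ≡ dist u v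
  walkLength-lShape (x₁ , y₁) (x₂ , y₂) y btw = begin
    walkLength (vertical x₁ w₁ ++ʷ (horizontal y w₂ ++ʷ vertical x₂ w₃))
      ≡⟨ length-++ʷ (vertical x₁ w₁) _ ⟩
    walkLength (vertical x₁ w₁) + walkLength (horizontal y w₂ ++ʷ vertical x₂ w₃)
      ≡⟨ cong (walkLength (vertical x₁ w₁) +_) (length-++ʷ (horizontal y w₂) _) ⟩
    walkLength (vertical x₁ w₁) + (walkLength (horizontal y w₂) + walkLength (vertical x₂ w₃))
      ≡⟨ cong₂ (λ a b → a + (b + _)) (length-mapʷ _ _ w₁) (length-mapʷ _ _ w₂) ⟩
    walkLength w₁ + (walkLength w₂ + walkLength (vertical x₂ w₃))
      ≡⟨ cong₂ (λ a b → a + (b + _)) (proj₂ (pathWalk y₁ y)) (proj₂ (pathWalk x₁ x₂)) ⟩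
    a + (c + walkLength (vertical x₂ w₃))
      ≡⟨ cong (λ t → a + (c + t)) (trans (length-mapʷ _ _ w₃) (proj₂ (pathWalk y y₂))) ⟩
    a + (c + d)
      ≡⟨ x+[y+z]≡y+[x+z] a c d ⟩
    c + (a + d)
      ≡⟨ cong (c +_) (Between⇒∣-∣-additive _ _ _ btw) ⟩
    c + ∣ toℕ y₁ - toℕ y₂ ∣
      ∎
    where
    open ≡-Reasoning
    w₁ = proj₁ (pathWalk y₁ y)
    w₂ = proj₁ (pathWalk x₁ x₂)
    w₃ = proj₁ (pathWalk y y₂)
    a = ∣ toℕ y₁ - toℕ y ∣
    c = ∣ toℕ x₁ - toℕ x₂ ∣
    d = ∣ toℕ y - toℕ y₂ ∣
    x+[y+z]≡y+[x+z] : ∀ x y z → x + (y + z) ≡ y + (x + z)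
    x+[y+z]≡y+[x+z] x y z = trans (sym (+-assoc x y z)) (trans (cong (_+ z) (+-comm x y)) (+-assoc y x z))

  lShape-isGeodesic : ∀ u v y → Between (row u) (toℕ y) (row v) → IsGeodesic (lShape u v y)
  lShape-isGeodesic u v y btw w = ≤-trans (≤-reflexive (walkLength-lShape u v y btw)) (dist≤walkLength w)

  ∈-lShape : ∀ u v y x → Between (col u) (toℕ x) (col v) → (x , y) ∈ walkVertices (lShape u v y)
  ∈-lShape (x₁ , y₁) (x₂ , y₂) y x btw =
    ∈-++ʷ⁺ʳ (vertical x₁ (proj₁ (pathWalk y₁ y))) _
      (∈-++ʷ⁺ˡ (horizontal y w) (vertical x₂ (proj₁ (pathWalk y y₂))) (∈-mapʷ⁺ _ _ w (between-visited w x btw)))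
    where w = proj₁ (pathWalk x₁ x₂)

  Tight : ∀ {u v} → Walk E u v → Set
  Tight {u} {v} w = walkLength w ≤ dist u v

  IsGeodesic⇒Tight : ∀ {u v} (w : Walk E u v) → IsGeodesic w → Tight w
  IsGeodesic⇒Tight {u} {v} w geo =
    ≤-trans (geo (lShape u v (proj₂ u))) (≤-reflexive (walkLength-lShape u v (proj₂ u) (between-refl _ _)))

  Tight-++ʷ : ∀ {u x v} (w₁ : Walk E u x) (w₂ : Walk E x v) → Tight (w₁ ++ʷ w₂) → Tight w₁ × Tight w₂
  Tight-++ʷ {u} {x} {v} w₁ w₂ t =
    +-cancelʳ-≤ (walkLength w₂) _ _ (≤-trans both (+-monoʳ-≤ (dist u x) (dist≤walkLength w₂))) ,
    +-cancelˡ-≤ (walkLength w₁) _ _ (≤-trans both (+-monoˡ-≤ (dist x v) (dist≤walkLength w₁)))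
    where
    both : walkLength w₁ + walkLength w₂ ≤ dist u x + dist x v
    both = ≤-trans (≤-reflexive (sym (length-++ʷ w₁ w₂))) (≤-trans t (dist-triangle u x v))

  Tight-sameColumn : ∀ {c y y'} (w : Walk E (c , y) (c , y')) → Tight w → c ∉ verticalCols w → y ≡ y'
  Tight-sameColumn (stop _) t c∉ = refl
  Tight-sameColumn (step (inj₁ _) w) t c∉ = ⊥-elim (c∉ (here refl))
  Tight-sameColumn {c} {y} {y'} (step {y = b , _} (inj₂ (refl , e)) w) t c∉ = ⊥-elim (<-irrefl refl (begin-strict
    Δ                                 <⟨ n<1+n Δ ⟩
    1 + Δ                             ≡⟨ cong (_+ Δ) (pathAdj⇒∣-∣≡1 (pathAdj-sym e)) ⟨
    ∣ toℕ b - toℕ c ∣ + Δ             ≤⟨ dist≤walkLength w ⟩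
    walkLength w                      <⟨ t ⟩
    ∣ toℕ c - toℕ c ∣ + Δ             ≡⟨ cong (_+ Δ) (∣n-n∣≡0 (toℕ c)) ⟩
    Δ                                 ∎))
    where
    open ≤-Reasoning
    Δ = ∣ toℕ y - toℕ y' ∣

  Tight-crossing-unique : ∀ {u v c y y'} (w : Walk E u v) → Tight w → c ∉ verticalCols w →
                          (c , y) ∈ walkVertices w → (c , y') ∈ walkVertices w → y ≡ y'
  Tight-crossing-unique w t c∉ p p' with w₁ , w₂ , refl ← splitʷ w p | ∈-++ʷ⁻ w₁ w₂ p'
  ... | inj₂ q with w₂₁ , w₂₂ , refl ← splitʷ w₂ q =
    Tight-sameColumn w₂₁ (proj₁ (Tight-++ʷ w₂₁ w₂₂ (proj₂ (Tight-++ʷ w₁ _ t))))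
      (c∉ ∘ ∈-verticalCols-++ʷ⁺ʳ w₁ _ ∘ ∈-verticalCols-++ʷ⁺ˡ w₂₁ w₂₂)
  ... | inj₁ q with w₁₁ , w₁₂ , refl ← splitʷ w₁ q =
    sym (Tight-sameColumn w₁₂ (proj₂ (Tight-++ʷ w₁₁ w₁₂ (proj₁ (Tight-++ʷ _ w₂ t))))
      (c∉ ∘ ∈-verticalCols-++ʷ⁺ˡ (w₁₁ ++ʷ w₁₂) w₂ ∘ ∈-verticalCols-++ʷ⁺ʳ w₁₁ w₁₂))

  length-verticalCols : ∀ {u v} (w : Walk E u v) → Tight w → length (verticalCols w) ≤ ∣ row u - row v ∣
  length-verticalCols {u} {v} w t = +-cancelˡ-≤ ∣ col u - col v ∣ _ _ (begin
    ∣ col u - col v ∣ + length (verticalCols w) ≤⟨ +-monoˡ-≤ _ (∣Δcol∣≤horizontalSteps w) ⟩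
    horizontalSteps w + length (verticalCols w) ≡⟨ walkLength≡horizontal+vertical w ⟨
    walkLength w                                ≤⟨ t ⟩
    dist u v                                    ∎)
    where open ≤-Reasoning

  Tight⇒Between-col : ∀ {u v x} (w : Walk E u v) → Tight w → x ∈ walkVertices w → Between (col u) (col x) (col v)
  Tight⇒Between-col {u} {v} {x} w t p with w₁ , w₂ , refl ← splitʷ w p =
    ∣-∣-additive⇒Between _ _ _ (+-cancelʳ-≤ ∣ row u - row v ∣ _ _ (begin
      (A + B) + ∣ row u - row v ∣                 ≤⟨ +-monoʳ-≤ (A + B) (∣-∣-triangle (row u) (row x) (row v)) ⟩
      (A + B) + (∣ row u - row x ∣ + ∣ row x - row v ∣) ≡⟨ interchange A B _ _ ⟩
      dist u x + dist x v                         ≤⟨ +-mono-≤ (dist≤walkLength w₁) (dist≤walkLength w₂) ⟩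
      walkLength w₁ + walkLength w₂               ≡⟨ length-++ʷ w₁ w₂ ⟨
      walkLength (w₁ ++ʷ w₂)                      ≤⟨ t ⟩
      dist u v                                    ∎))
    where
    open ≤-Reasoning
    A = ∣ col u - col x ∣
    B = ∣ col x - col v ∣

orient : ∀ {A : Set} {P : Set} → Dec P → A → A → A × A
orient (yes _) a b = a , b
orient (no _) a b = b , a

orient-injective : ∀ {m} {P P' : Set} (d : Dec P) (d' : Dec P') {i j i' j' : Fin m} →
                   toℕ i < toℕ j → toℕ i' < toℕ j' → orient d i j ≡ orient d' i' j' → i ≡ i' × j ≡ j'
orient-injective (yes _) (yes _) _ _ refl = refl , refl
orient-injective (no _) (no _) _ _ refl = refl , refl
orient-injective (yes _) (no _) i<j i'<j' refl = ⊥-elim (<-asym i<j i'<j')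
orient-injective (no _) (yes _) i<j i'<j' refl = ⊥-elim (<-asym i<j i'<j')

4[m*n]≤[m+n]*[m+n] : ∀ m n → 4 * (m * n) ≤ (m + n) * (m + n)
4[m*n]≤[m+n]*[m+n] m n with ≤-total m n
... | inj₁ m≤n with d , refl ← m≤n⇒∃[o]m+o≡n m≤n = ≤-trans (m≤m+n _ (d * d)) (≤-reflexive (square-gap m d))
  where
  square-gap : ∀ m d → 4 * (m * (m + d)) + d * d ≡ (m + (m + d)) * (m + (m + d))
  square-gap = solve-∀
... | inj₂ n≤m with d , refl ← m≤n⇒∃[o]m+o≡n n≤m = ≤-trans (m≤m+n _ (d * d)) (≤-reflexive (square-gap n d))
  where
  square-gap : ∀ n d → 4 * ((n + d) * n) + d * d ≡ ((n + d) + n) * ((n + d) + n)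
  square-gap = solve-∀

module LowerBound (r n : ℕ) where
  open Grid r n

  ∣Δrow∣≤n∸1 : (a b : Fin n) → ∣ toℕ a - toℕ b ∣ ≤ n ∸ 1
  ∣Δrow∣≤n∸1 a b = ≤-trans (∣m-n∣≤m⊔n (toℕ a) (toℕ b)) (⊔-lub (<⇒≤∸1 (toℕ<n a)) (<⇒≤∸1 (toℕ<n b)))
    where
    <⇒≤∸1 : ∀ {x m} → x < m → x ≤ m ∸ 1
    <⇒≤∸1 {m = suc _} (s≤s x≤m) = x≤m

  module _ (S : List V)
           (P : (i j : Fin (length S)) → toℕ i < toℕ j → Walk E (lookup S i) (lookup S j))
           (geo : (i j : Fin (length S)) (h : toℕ i < toℕ j) → IsGeodesic (P i j h))
           (cover : (v : V) → Σ (Fin (length S)) λ i → Σ (Fin (length S)) λ j →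
                      Σ (toℕ i < toℕ j) λ h → v ∈ walkVertices (P i j h))
           where

    private
      s = length S
      colS : Fin s → ℕ
      colS i = col (lookup S i)
      tight : ∀ i j h → Tight (P i j h)
      tight i j h = IsGeodesic⇒Tight (P i j h) (geo i j h)

    freeColumn : (s C 2) * (n ∸ 1) + s < r →
                 Σ (Fin r) λ c → (∀ i → proj₁ (lookup S i) ≢ c) × (∀ i j h → c ∉ verticalCols (P i j h))
    freeColumn hr =
      c , (λ i eq → c∉ (∈-++⁺ʳ vcs (subst (_∈ map proj₁ S) eq (∈-map⁺ proj₁ (∈-lookup i))))) ,
          (λ i j h c∈ → c∉ (∈-++⁺ˡ (vcs⊇ i j h c∈)))
      where
      pairs = unionOverPairs s (n ∸ 1) (λ i j h → verticalCols (P i j h))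
                (λ i j h → ≤-trans (length-verticalCols (P i j h) (tight i j h))
                                   (∣Δrow∣≤n∸1 (proj₂ (lookup S i)) (proj₂ (lookup S j))))
      vcs = proj₁ pairs
      vcs⊇ = proj₂ (proj₂ pairs)
      length< : length (vcs ++ map proj₁ S) < r
      length< = ≤-<-trans (≤-trans (≤-reflexive (length-++ vcs))
                  (+-mono-≤ (proj₁ (proj₂ pairs)) (≤-reflexive (length-map proj₁ S)))) hr
      free = short⇒∃∉ (vcs ++ map proj₁ S) length<
      c = proj₁ free
      c∉ = proj₂ free

    module Crossing (c : Fin r) (c∉S : ∀ i → proj₁ (lookup S i) ≢ c)
                    (c∉P : ∀ i j h → c ∉ verticalCols (P i j h)) where

      src tgt : Fin n → Fin s
      src y = proj₁ (cover (c , y))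
      tgt y = proj₁ (proj₂ (cover (c , y)))

      src<tgt : ∀ y → toℕ (src y) < toℕ (tgt y)
      src<tgt y = proj₁ (proj₂ (proj₂ (cover (c , y))))

      on : ∀ y → (c , y) ∈ walkVertices (P (src y) (tgt y) (src<tgt y))
      on y = proj₂ (proj₂ (proj₂ (cover (c , y))))

      separates : ∀ y → (colS (src y) < toℕ c × toℕ c < colS (tgt y)) ⊎
                        (colS (tgt y) < toℕ c × toℕ c < colS (src y))
      separates y = Between-strict (Tight⇒Between-col _ (tight _ _ _) (on y))
                      (c∉S (src y) ∘ toℕ-injective) (c∉S (tgt y) ∘ toℕ-injective)

      crossingPair : Fin n → Fin s × Fin s
      crossingPair y = orient (colS (src y) <? toℕ c) (src y) (tgt y)

      crossingPair-injective : ∀ {y y'} → crossingPair y ≡ crossingPair y' → y ≡ y'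
      crossingPair-injective {y} {y'} eq
        with src≡ , tgt≡ ← orient-injective (colS (src y) <? toℕ c) (colS (src y') <? toℕ c)
                                             (src<tgt y) (src<tgt y') eq =
        crosses-once (src<tgt y) (src<tgt y') src≡ tgt≡ (on y) (on y')
        where
        crosses-once : ∀ {i j i' j'} (h : toℕ i < toℕ j) (h' : toℕ i' < toℕ j') → i ≡ i' → j ≡ j' →
                       ∀ {y y'} → (c , y) ∈ walkVertices (P i j h) → (c , y') ∈ walkVertices (P i' j' h') → y ≡ y'
        crosses-once h h' refl refl p p' with refl ← <-irrelevant h h' =
          Tight-crossing-unique _ (tight _ _ _) (c∉P _ _ _) p p'

      left right : List (Fin s)
      left = filter (λ i → colS i <? toℕ c) (allFin s)
      right = filter (λ i → toℕ c <? colS i) (allFin s)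

      ∈-left : ∀ {i} → colS i < toℕ c → i ∈ left
      ∈-left {i} = ∈-filter⁺ (λ i → colS i <? toℕ c) (∈-allFin i)

      ∈-right : ∀ {i} → toℕ c < colS i → i ∈ right
      ∈-right {i} = ∈-filter⁺ (λ i → toℕ c <? colS i) (∈-allFin i)

      crossingPair∈ : ∀ y → crossingPair y ∈ cartesianProduct left right
      crossingPair∈ y with colS (src y) <? toℕ c | separates y
      ... | yes src<c | inj₁ (_ , c<tgt) = ∈-cartesianProduct⁺ (∈-left src<c) (∈-right c<tgt)
      ... | yes src<c | inj₂ (_ , c<src) = ⊥-elim (<-asym src<c c<src)
      ... | no src≮c | inj₁ (src<c , _) = ⊥-elim (src≮c src<c)
      ... | no _ | inj₂ (tgt<c , c<src) = ∈-cartesianProduct⁺ (∈-left tgt<c) (∈-right c<src)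

      n≤left*right : n ≤ length left * length right
      n≤left*right = ≤-trans (injection⇒≤length crossingPair crossingPair-injective crossingPair∈)
                             (≤-reflexive (length-cartesianProduct left right))

      left+right≤s : length left + length right ≤ s
      left+right≤s =
        ≤-trans (length-filter-disjoint (λ i → colS i <? toℕ c) (λ i → toℕ c <? colS i) <-asym (allFin s))
                (≤-reflexive (length-tabulate (λ i → i)))

      4n≤s*s : 4 * n ≤ s * s
      4n≤s*s = begin
        4 * n                                         ≤⟨ *-monoʳ-≤ 4 n≤left*right ⟩
        4 * (length left * length right)              ≤⟨ 4[m*n]≤[m+n]*[m+n] (length left) (length right) ⟩
        (length left + length right) * (length left + length right) ≤⟨ *-mono-≤ left+right≤s left+right≤s ⟩
        s * s                                         ∎
        where open ≤-Reasoning

  4n≤|S|*|S| : (S : List V) → IsStrongGeodeticSet E S → (length S C 2) * (n ∸ 1) + length S < r →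
               4 * n ≤ length S * length S
  4n≤|S|*|S| S (_ , P , geo , cover) hr with c , c∉S , c∉P ← freeColumn S P geo cover hr =
    Crossing.4n≤s*s S P geo cover c c∉S c∉P

  lowerBound : ∀ k → (∀ j → j < k → j * j < 4 * n) → (k C 2) * (n ∸ 1) + k < r →
               (S : List V) → IsStrongGeodeticSet E S → k ≤ length S
  lowerBound k below hr S strong with k ≤? length S
  ... | yes k≤s = k≤s
  ... | no k≰s = ⊥-elim (<⇒≱ (below (length S) s<k) (4n≤|S|*|S| S strong hr'))
    where
    s<k = ≰⇒> k≰s
    hr' : (length S C 2) * (n ∸ 1) + length S < r
    hr' = ≤-<-trans (+-mono-≤ (*-monoˡ-≤ (n ∸ 1) (nC2-mono (<⇒≤ s<k))) (<⇒≤ s<k)) hr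

between-shifted : ∀ p q β → β ≤ p → q ≤ β → q ≤ p + q ∸ β × p + q ∸ β ≤ p
between-shifted p q β β≤p q≤β with d , refl ← m≤n⇒∃[o]m+o≡n β≤p =
  subst (λ t → q ≤ t × t ≤ β + d) (sym β+d+q∸β≡d+q)
        (m≤n+m q d , ≤-trans (≤-reflexive (+-comm d q)) (+-monoˡ-≤ d q≤β))
  where
  β+d+q∸β≡d+q : β + d + q ∸ β ≡ d + q
  β+d+q∸β≡d+q = trans (cong (_∸ β) (+-assoc β d q)) (m+n∸m≡n β (d + q))

module UpperBound (r' m α β : ℕ) (n≤[1+α]b : suc m ≤ suc α * suc β) (αb≤m : α * suc β ≤ m) (1≤α : 1 ≤ α) where
  open Grid (suc (suc r')) (suc m)

  b : ℕ
  b = suc β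

  β≤m : β ≤ m
  β≤m = ≤-trans (n≤1+n β) (≤-trans (≤-reflexive (sym (*-identityˡ b))) (≤-trans (*-monoˡ-≤ b 1≤α) αb≤m))

  clamp : ℕ → Fin (suc m)
  clamp t = fromℕ< (s≤s (m⊓n≤n t m))

  toℕ-clamp : ∀ t → toℕ (clamp t) ≡ t ⊓ m
  toℕ-clamp t = toℕ-fromℕ< (s≤s (m⊓n≤n t m))

  toℕ-clamp-id : ∀ {t} → t ≤ m → toℕ (clamp t) ≡ t
  toℕ-clamp-id {t} t≤m = trans (toℕ-clamp t) (m≤n⇒m⊓n≡m t≤m)

  lastCol : Fin (suc (suc r'))
  lastCol = fsuc (fromℕ r')

  left : Fin (suc α) → V
  left i = fzero , clamp (toℕ i * b + β)

  right : Fin b → V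
  right t = lastCol , inject≤ t (s≤s β≤m)

  S : List V
  S = map left (allFin (suc α)) ++ map right (allFin b)

  length-S : length S ≡ suc α + b
  length-S = trans (length-++ (map left (allFin (suc α))))
               (cong₂ _+_ (trans (length-map left (allFin (suc α))) (length-tabulate {n = suc α} (λ i → i)))
                          (trans (length-map right (allFin b)) (length-tabulate {n = b} (λ i → i))))

  row-left-strict : ∀ {i j : Fin (suc α)} → toℕ i < toℕ j → row (left i) < row (left j)
  row-left-strict {i} {j} i<j = begin-strict
    toℕ (clamp (toℕ i * b + β)) ≡⟨ toℕ-clamp _ ⟩
    (toℕ i * b + β) ⊓ m         ≤⟨ m⊓n≤m _ m ⟩
    toℕ i * b + β               <⟨ ⊓-glb (+-monoˡ-< β (*-monoˡ-< b i<j)) below-m ⟩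
    (toℕ j * b + β) ⊓ m         ≡⟨ toℕ-clamp _ ⟨
    toℕ (clamp (toℕ j * b + β)) ∎
    where
    open ≤-Reasoning
    below-m : toℕ i * b + β < m
    below-m = begin-strict
      toℕ i * b + β   <⟨ s≤s (≤-reflexive (+-comm (toℕ i * b) β)) ⟩
      suc (toℕ i) * b ≤⟨ *-monoˡ-≤ b (≤-trans i<j (s≤s⁻¹ (toℕ<n j))) ⟩
      α * b           ≤⟨ αb≤m ⟩
      m               ∎

  left-injective : ∀ {i j} → left i ≡ left j → i ≡ j
  left-injective {i} {j} eq with <-cmp (toℕ i) (toℕ j)
  ... | tri< i<j _ _ = ⊥-elim (<⇒≢ (row-left-strict i<j) (cong (toℕ ∘ proj₂) eq))
  ... | tri≈ _ i≡j _ = toℕ-injective i≡j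
  ... | tri> _ _ j<i = ⊥-elim (<⇒≢ (row-left-strict j<i) (cong (toℕ ∘ proj₂) (sym eq)))

  right-injective : ∀ {s t} → right s ≡ right t → s ≡ t
  right-injective {s} {t} eq = inject≤-injective _ _ s t (cong proj₂ eq)

  S-unique : Unique S
  S-unique = ++⁺ (map⁺ {f = left} left-injective (allFin⁺ (suc α)))
                 (map⁺ {f = right} right-injective (allFin⁺ b)) disjoint
    where
    disjoint : ∀ {v} → ¬ (v ∈ map left (allFin (suc α)) × v ∈ map right (allFin b))
    disjoint (v∈L , v∈R) with ∈-map⁻ left {xs = allFin (suc α)} v∈L | ∈-map⁻ right {xs = allFin b} v∈R
    ... | _ , _ , v≡left | _ , _ , v≡right = fzero≢fsuc (cong proj₁ (trans (sym v≡left) v≡right))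

  Anchored : V → Set
  Anchored u = (proj₁ u ≡ fzero × β ≤ row u) ⊎ (proj₁ u ≡ lastCol × row u ≤ β)

  S-anchored : ∀ {u} → u ∈ S → Anchored u
  S-anchored u∈S with ∈-++⁻ (map left (allFin (suc α))) u∈S
  ... | inj₁ u∈L with i , _ , refl ← ∈-map⁻ left {xs = allFin (suc α)} u∈L =
    inj₁ (refl , subst (β ≤_) (sym (toℕ-clamp _)) (⊓-glb (m≤n+m β (toℕ i * b)) β≤m))
  ... | inj₂ u∈R with t , _ , refl ← ∈-map⁻ right {xs = allFin b} u∈R =
    inj₂ (refl , subst (_≤ β) (sym (toℕ-inject≤ t _)) (s≤s⁻¹ (toℕ<n t)))

  turn : V → V → Fin (suc m)
  turn (fzero , y) (fsuc _ , y') = clamp (toℕ y + toℕ y' ∸ β)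
  turn (fsuc _ , y) (fzero , y') = clamp (toℕ y' + toℕ y ∸ β)
  turn (_ , y) _ = y

  turn-between : ∀ u v → Anchored u → Anchored v → Between (row u) (toℕ (turn u v)) (row v)
  turn-between (_ , y) (_ , y') (inj₁ (refl , _)) (inj₁ (refl , _)) = between-refl _ _
  turn-between (_ , y) (_ , y') (inj₂ (refl , _)) (inj₂ (refl , _)) = between-refl _ _
  turn-between (_ , y) (_ , y') (inj₁ (refl , β≤y)) (inj₂ (refl , y'≤β))
    with y'≤t , t≤y ← between-shifted (toℕ y) (toℕ y') β β≤y y'≤β =
    inj₂ (subst (λ t → toℕ y' ≤ t × t ≤ toℕ y) (sym (toℕ-clamp-id (≤-trans t≤y (s≤s⁻¹ (toℕ<n y))))) (y'≤t , t≤y))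
  turn-between (_ , y) (_ , y') (inj₂ (refl , y≤β)) (inj₁ (refl , β≤y'))
    with y≤t , t≤y' ← between-shifted (toℕ y') (toℕ y) β β≤y' y≤β =
    inj₁ (subst (λ t → toℕ y ≤ t × t ≤ toℕ y') (sym (toℕ-clamp-id (≤-trans t≤y' (s≤s⁻¹ (toℕ<n y'))))) (y≤t , t≤y'))

  turn-covers : (y : Fin (suc m)) → Σ (Fin (suc α)) λ i → Σ (Fin b) λ t → turn (left i) (right t) ≡ y
  turn-covers y = fromℕ< i<1+α , fromℕ< (s≤s q≤β) , toℕ-injective (begin
    toℕ (clamp (toℕ (clamp (toℕ (fromℕ< i<1+α) * b + β)) + toℕ (inject≤ (fromℕ< (s≤s q≤β)) _) ∸ β))
      ≡⟨ toℕ-clamp _ ⟩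
    (toℕ (clamp (toℕ (fromℕ< i<1+α) * b + β)) + toℕ (inject≤ (fromℕ< (s≤s q≤β)) _) ∸ β) ⊓ m
      ≡⟨ cong₂ (λ a c → (a + c ∸ β) ⊓ m) (trans (toℕ-clamp _) (cong (λ a → (a * b + β) ⊓ m) (toℕ-fromℕ< i<1+α)))
                                           (trans (toℕ-inject≤ _ _) (toℕ-fromℕ< (s≤s q≤β))) ⟩
    (p + (toℕ y + β ∸ p) ∸ β) ⊓ m
      ≡⟨ cong (λ a → (a ∸ β) ⊓ m) (m+[n∸m]≡n p≤y+β) ⟩
    (toℕ y + β ∸ β) ⊓ m
      ≡⟨ cong (_⊓ m) (m+n∸n≡m (toℕ y) β) ⟩
    toℕ y ⊓ m
      ≡⟨ m≤n⇒m⊓n≡m y≤m ⟩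
    toℕ y ∎)
    where
    open ≡-Reasoning
    y≤m : toℕ y ≤ m
    y≤m = s≤s⁻¹ (toℕ<n y)
    i : ℕ
    i = toℕ y / b
    i<1+α : i < suc α
    i<1+α = m<n*o⇒m/o<n (≤-trans (s≤s y≤m) n≤[1+α]b)
    p : ℕ
    p = (i * b + β) ⊓ m
    y≤p : toℕ y ≤ p
    y≤p = ⊓-glb (≤-trans (≤-reflexive (m≡m%n+[m/n]*n (toℕ y) b))
                   (≤-trans (+-monoˡ-≤ (i * b) (s≤s⁻¹ (m%n<n (toℕ y) b))) (≤-reflexive (+-comm β (i * b))))) y≤m
    p≤y+β : p ≤ toℕ y + β
    p≤y+β = ≤-trans (m⊓n≤m _ m) (+-monoˡ-≤ β (m/n*n≤m (toℕ y) b))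
    q≤β : toℕ y + β ∸ p ≤ β
    q≤β = ≤-trans (∸-monoʳ-≤ (toℕ y + β) y≤p) (≤-reflexive (m+n∸m≡n (toℕ y) β))

  upperBound : Σ (List V) λ S → IsStrongGeodeticSet E S × length S ≡ suc α + suc β
  upperBound = S , isStrongGeodeticSet-fromWalks S S-unique selected geodesic covered , length-S
    where
    selected : (u v : V) → Walk E u v
    selected u v = lShape u v (turn u v)
    geodesic : ∀ {u v} → u ∈ S → v ∈ S → IsGeodesic (selected u v)
    geodesic {u} {v} u∈S v∈S =
      lShape-isGeodesic u v (turn u v) (turn-between u v (S-anchored u∈S) (S-anchored v∈S))
    covered : ∀ z → Σ V λ u → Σ V λ v → u ∈ S × v ∈ S × u ≢ v ×
                    z ∈ walkVertices (selected u v) × z ∈ walkVertices (selected v u)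
    covered (x , y) with i , t , turn≡y ← turn-covers y =
      left i , right t ,
      ∈-++⁺ˡ (∈-map⁺ left (∈-allFin i)) , ∈-++⁺ʳ (map left (allFin (suc α))) (∈-map⁺ right (∈-allFin t)) ,
      (λ eq → fzero≢fsuc (cong proj₁ eq)) ,
      subst (λ w → (x , w) ∈ walkVertices (selected (left i) (right t))) turn≡y
        (∈-lShape (left i) (right t) _ x (inj₁ (z≤n , x≤lastCol))) ,
      subst (λ w → (x , w) ∈ walkVertices (selected (right t) (left i))) turn≡y
        (∈-lShape (right t) (left i) _ x (inj₂ (z≤n , x≤lastCol)))
      where
      x≤lastCol : toℕ x ≤ toℕ lastCol
      x≤lastCol = ≤-trans (s≤s⁻¹ (toℕ<n x)) (≤-reflexive (cong suc (sym (toℕ-fromℕ r'))))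

upperBound : ∀ r m α β → suc m ≤ suc α * suc β → α * suc β ≤ m → 1 ≤ α → 2 ≤ r →
             Σ (List (Fin r × Fin (suc m))) λ S →
               IsStrongGeodeticSet (GridAdj r (suc m)) S × length S ≡ suc α + suc β
upperBound (suc (suc r')) m α β n≤[1+α]b αb≤m 1≤α (s≤s (s≤s z≤n)) =
  UpperBound.upperBound r' m α β n≤[1+α]b αb≤m 1≤α

halve : ∀ k → Σ ℕ λ h → k ≡ h + h ⊎ k ≡ suc (h + h)
halve zero = 0 , inj₁ refl
halve (suc k) with halve k
... | h , inj₁ refl = h , inj₂ refl
... | h , inj₂ refl = suc h , inj₁ (cong suc (sym (+-suc h h)))

-- k splits into halves a = α + 1 ≥ b = β + 1; 4n ≤ k² gives n ≤ ab and (k - 1)² < 4n gives (a - 1)b < n.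
ceil2√-split : ∀ n' k → IsCeil2Sqrt (suc (suc n')) k →
  Σ ℕ λ α → Σ ℕ λ β → k ≡ suc α + suc β × suc (suc n') ≤ suc α * suc β × α * suc β ≤ suc n' × 1 ≤ α
ceil2√-split n' k (4n≤k² , below) with halve k
... | zero , inj₁ refl = ⊥-elim (<⇒≱ (s≤s z≤n) 4n≤k²)
... | suc zero , inj₁ refl = ⊥-elim (<⇒≱ (≤-trans (m≤m+n 5 3) (*-monoʳ-≤ 4 (s≤s (s≤s (z≤n {n'}))))) 4n≤k²)
... | suc (suc c) , inj₁ refl =
  suc c , suc c , refl ,
  *-cancelˡ-≤ 4 (≤-trans 4n≤k² (≤-reflexive (even² (suc c)))) ,
  s≤s⁻¹ (*-cancelˡ-< 4 _ _ (<-trans (n<1+n _) (subst (_< 4 * suc (suc n')) (odd² (suc c)) (below _ ≤-refl)))) ,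
  s≤s z≤n
  where
  even² : ∀ h → (suc h + suc h) * (suc h + suc h) ≡ 4 * (suc h * suc h)
  even² = solve-∀
  odd² : ∀ h → (h + suc h) * (h + suc h) ≡ suc (4 * (h * suc h))
  odd² = solve-∀
... | zero , inj₂ refl = ⊥-elim (<⇒≱ (s≤s (s≤s z≤n)) 4n≤k²)
... | suc h , inj₂ refl =
  suc h , h , refl ,
  s≤s⁻¹ (*-cancelˡ-< 4 _ _ (begin-strict
    4 * suc (suc n')             ≤⟨ 4n≤k² ⟩
    suc (suc h + suc h) * suc (suc h + suc h) ≡⟨ odd² (suc h) ⟩
    suc (4 * x)                  <⟨ m≤n+m (suc (suc (4 * x))) 2 ⟩
    4 + 4 * x                    ≡⟨ *-suc 4 x ⟨
    4 * suc x                    ∎)) ,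
  s≤s⁻¹ (*-cancelˡ-< 4 _ _ (subst (_< 4 * suc (suc n')) (even² (suc h)) (below _ ≤-refl))) ,
  s≤s z≤n
  where
  odd² : ∀ h → suc (h + h) * suc (h + h) ≡ suc (4 * (suc h * h))
  odd² = solve-∀
  even² : ∀ h → (h + h) * (h + h) ≡ 4 * (h * h)
  even² = solve-∀
  open ≤-Reasoning
  x = suc (suc h) * suc h

theorem3p2 : (n r k : ℕ) → 2 ≤ n → IsCeil2Sqrt n k →
    (k C 2) * (n ∸ 1) + k < r →
    StrongGeodeticNumberIs (GridAdj r n) k
theorem3p2 (suc (suc n')) r k (s≤s (s≤s z≤n)) ceil hr
  with α , β , refl , n≤[1+α][1+β] , α[1+β]≤n∸1 , 1≤α ← ceil2√-split n' k ceil =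
  upperBound r (suc n') α β n≤[1+α][1+β] α[1+β]≤n∸1 1≤α 2≤r ,
  LowerBound.lowerBound r (suc (suc n')) (suc α + suc β) (proj₂ ceil) hr
  where
  2≤r : 2 ≤ r
  2≤r = ≤-trans (s≤s (s≤s z≤n)) (≤-<-trans (m≤n+m (suc α + suc β) _) hr)
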